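{- Let $T$ be a finite rooted tree with the weights $lw(\cdot)$ and $pw(\cdot)$ defined as in the context. Then for every apex node $u$ and every node $v$ of $T$, \[ pw(u)\le 3e^{\pi^2}|T_u|,\qquad lw(v)\le 3e^{\pi^2}|T_v^\ell|. \]
   Context: For $x>0$, $\lg x=\max(1,\log_2 x)$. In a finite rooted tree $T$, $T_u$ is the subtree rooted at $u$ and $|T_u|$ its number of nodes. Heavy-light decomposition: for a non-leaf node $u$, $heavy(u)$ is a child $v$ of $u$ maximizing $|T_v|$ (one fixed choice); the edge $(u,heavy(u))$ is heavy, the other children of $u$ are its light children. A node is an apex node if it is the root or the edge to its parent is light. The light subtree is $T_u^\ell=T_u\setminus T_{heavy(u)}$ (for a leaf, $T_u^\ell=\{u\}$). A heavy path is a maximal path $(u_1,\ldots,u_t)$ with $u_{i+1}=heavy(u_i)$; $u_1$ is an apex node, and every node lies on exactly one heavy path. Define $\gamma(u)=\lfloor\lg|T_u|\rfloor$ if $u$ is an apex node and $\gamma(u)=\lfloor\lg|T_u^\ell|\rfloor$ otherwise, and $wc(u)=\lfloor\lg\gamma(u)\rfloor$. A $(1+\varepsilon)$-approximation of a non-negative number $a$ is a number $b$ with $a\le b<(1+\varepsilon)a$ (and $b=0$ if $a=0$). Weights are defined recursively: for a node $u$ and $1\le i\le wc(u)$, let $b_i(u)=\sum pw(v)$ over light children $v$ of $u$ with $wc(v)=i$; set $a_0(u)=0$ and, for $i=1,\ldots,wc(u)$, let $a_i(u)$ be a $(1+\gamma(u)^{ -3})$-approximation of $a_{i-1}(u)+b_i(u)$;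 set $lw(u)=1+a_{wc(u)}(u)$. For a heavy path $(u_1,\ldots,u_t)$ let $k'(u_i)=\gamma(u_i)-\lceil 2\lg\gamma(u_i)\rceil+1$, $k(u_i)=\max_{1\le j\le t}\bigl(k'(u_j)-|i-j|\bigr)$, and $pw(u_1)=\sum_{i=1}^{t}\bigl(lw(u_i)+2^{k(u_i)}-1\bigr)$.
   Formalization: The $(1+\varepsilon)$-approximations $a_i(u)$ chosen in the recursive definition of the weights take only rational values, so the weights lw and pw are rational. -}

module Defs where

open import Data.Bool using (Bool; true; false; if_then_else_)
open import Data.Nat as ℕ using (ℕ; zero; suc; _∸_; _⊔_; _^_; _!; ∣_-_∣; _≡ᵇ_)
open import Data.Nat.Logarithm using (⌊log₂_⌋; ⌈log₂_⌉)
open import Data.Integer using (+_)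
open import Data.Rational as ℚ using (ℚ; 0ℚ; 1ℚ; _+_; _*_; _/_)
open import Data.List using (List; []; _∷_; foldr; zip; upTo; length)
open import Data.List.Relation.Unary.All using (All)
open import Data.List.Membership.Propositional using (_∈_)
open import Data.Product using (_×_; ∃)
open import Data.Sum using (_⊎_)
open import Relation.Binary.PropositionalEquality using (_≡_)

-- A non-leaf node stores its heavy child separately from its (list of)
-- light children; every node carries a label of type A (used below to
-- carry the choice of the (1+ε)-approximations made at that node).

data HTree (A : Set) : Set where
  leaf : A → HTree A
  node : A → (heavy : HTree A) → (lights : List (HTree A)) → HTree A

label : ∀ {A} → HTree A → A
label (leaf a) = a
label (node a _ _) = a

mutual
  size : ∀ {A} → HTree A → ℕ
  size (leaf _) = 1
  size (node _ h ls) = suc (size h ℕ.+ sizes ls)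

  sizes : ∀ {A} → List (HTree A) → ℕ
  sizes [] = 0
  sizes (t ∷ ts) = size t ℕ.+ sizes ts

-- |T_u^ℓ| = |T_u| - |T_heavy(u)|  (and 1 for a leaf)
lsize : ∀ {A} → HTree A → ℕ
lsize (leaf _) = 1
lsize (node _ _ ls) = suc (sizes ls)

data WellHeavy {A : Set} : HTree A → Set where
  leaf : ∀ {a} → WellHeavy (leaf a)
  node : ∀ {a h ls} → WellHeavy h → All (λ l → size l ℕ.≤ size h) ls →
         All WellHeavy ls → WellHeavy (node a h ls)

data Node {A : Set} : HTree A → Set where
  here  : ∀ {t} → Node t
  heavy : ∀ {a h ls} → Node h → Node (node a h ls)
  light : ∀ {a h ls l} → l ∈ ls → Node l → Node (node a h ls)

sub : ∀ {A} {t : HTree A} → Node t → HTree A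
sub {t = t} here = t
sub (heavy p) = sub p
sub (light _ p) = sub p

-- b = whether the edge into the current subtree root is light (or it is the root)
apexFrom : ∀ {A} {t : HTree A} → Bool → Node t → Bool
apexFrom b here = b
apexFrom _ (heavy p) = apexFrom false p
apexFrom _ (light _ p) = apexFrom true p

isApex : ∀ {A} {t : HTree A} → Node t → Bool
isApex = apexFrom true

-- ⌊lg n⌋ = ⌊max(1, log₂ n)⌋ = max(1, ⌊log₂ n⌋)
flg : ℕ → ℕ
flg n = 1 ⊔ ⌊log₂ n ⌋

-- ⌈2 lg n⌉ = max(2, ⌈log₂ (n²)⌉)
c2lg : ℕ → ℕ
c2lg n = 2 ⊔ ⌈log₂ (n ℕ.* n) ⌉

-- γ(u); the Bool says whether u is an apex node
gam : ∀ {A} → Bool → HTree A → ℕ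
gam true t = flg (size t)
gam false t = flg (lsize t)

wc : ∀ {A} → Bool → HTree A → ℕ
wc b t = flg (gam b t)

-- k'(u) = γ(u) - ⌈2 lg γ(u)⌉ + 1   (always ≥ 0, so ℕ-subtraction is exact)
k' : ℕ → ℕ
k' g = suc g ∸ c2lg g

fromℕ : ℕ → ℚ
fromℕ n = (+ n) / 1

-- 1/n  (only used with n ≥ 1)
inv : ℕ → ℚ
inv zero = 0ℚ
inv (suc n) = (+ 1) / suc n

IsApprox : ℚ → ℚ → ℚ → Set
IsApprox ε a b = (a ≡ 0ℚ × b ≡ 0ℚ) ⊎ (a ℚ.≤ b × b ℚ.< (1ℚ + ε) * a)

-- Approximation choices: at every node u, an "oracle" α : ℕ → ℚ → ℚ
-- with a_i(u) = α i (a_{i-1}(u) + b_i(u)).  Every concrete choice of the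
-- a_i(u) arises this way.

Oracle : Set
Oracle = ℕ → ℚ → ℚ

GoodOracle : ℕ → Oracle → Set
GoodOracle g α = ∀ (i : ℕ) (x : ℚ) → 1 ℕ.≤ i → i ℕ.≤ flg g → 0ℚ ℚ.≤ x →
                 IsApprox (inv (g ^ 3)) x (α i x)

data Valid : Bool → HTree Oracle → Set where
  leaf : ∀ {b α} → GoodOracle (gam b (leaf α)) α → Valid b (leaf α)
  node : ∀ {b α h ls} → GoodOracle (gam b (node α h ls)) α →
         Valid false h → All (Valid true) ls → Valid b (node α h ls)

iterA : Oracle → (ℕ → ℚ) → ℕ → ℚ
iterA α B zero = 0ℚ
iterA α B (suc n) = α (suc n) (iterA α B n + B (suc n))

-- k(u_i) = max_j (k'(u_j) - |i-j|), for a heavy path with k'-values ks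
kAt : List ℕ → ℕ → ℕ
kAt ks i = foldr (λ p m → (Data.Product.proj₂ p ∸ ∣ i - Data.Product.proj₁ p ∣) ⊔ m) 0
                 (zip (upTo (length ks)) ks)

gams : ∀ {A} → Bool → HTree A → List ℕ
gams b t@(leaf _) = gam b t ∷ []
gams b t@(node _ h _) = gam b t ∷ gams false h

sumPath : List ℕ → ℕ → List ℚ → ℚ
sumPath ks i [] = 0ℚ
sumPath ks i (w ∷ ws) = (w + fromℕ (2 ^ kAt ks i ∸ 1)) + sumPath ks (suc i) ws

mutual
  lw : Bool → HTree Oracle → ℚ
  lw b t@(leaf α) = 1ℚ + iterA α (λ _ → 0ℚ) (wc b t)
  lw b t@(node α h ls) = 1ℚ + iterA α (λ i → bsum i ls) (wc b t)

  bsum : ℕ → List (HTree Oracle) → ℚ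
  bsum i [] = 0ℚ
  bsum i (l ∷ ls) = (if wc true l ≡ᵇ i then pw l else 0ℚ) + bsum i ls

  lws : Bool → HTree Oracle → List ℚ
  lws b t@(leaf _) = lw b t ∷ []
  lws b t@(node _ h _) = lw b t ∷ lws false h

  -- pw(u) for an apex node u (heavy path indices i = 0,…,t-1)
  pw : HTree Oracle → ℚ
  pw t = sumPath (mapk (gams true t)) 0 (lws true t)

  mapk : List ℕ → List ℕ
  mapk [] = []
  mapk (g ∷ gs) = k' g ∷ mapk gs

-- The constant 3 e^{π²}, via rational approximations from below:
--   P_N = 6 Σ_{j=1}^N 1/j²  ↑ π²,   E_N = Σ_{k=0}^N P_N^k / k!  ↑ e^{π²}.
-- x ≤ 3e^{π²}·n  iff  ∀ ε > 0, ∃ N, x < 3·n·E_N + ε.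

powℚ : ℚ → ℕ → ℚ
powℚ q zero = 1ℚ
powℚ q (suc k) = q * powℚ q k

zeta2 : ℕ → ℚ
zeta2 zero = 0ℚ
zeta2 (suc j) = inv (suc j ℕ.* suc j) + zeta2 j

expSum : ℚ → ℕ → ℚ
expSum q zero = 1ℚ
expSum q (suc k) = powℚ q (suc k) * inv (suc k !) + expSum q k

E : ℕ → ℚ
E N = expSum (fromℕ 6 * zeta2 N) N

_≤3eπ²*_ : ℚ → ℕ → Set
x ≤3eπ²* n = ∀ (ε : ℚ) → 0ℚ ℚ.< ε → ∃ λ N → x ℚ.< fromℕ (3 ℕ.* n) * E N + ε

-- For an apex node u with ⌊log₂ |T_u|⌋ = m we show pw(u) ≤ W_m |T_u|, where
-- W_{m+1} = (1 + 2/q²) W_m + 32/q² with q = max(1, m); since Π (1 + 2/q²) converges,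
-- W_m ≤ 2940 ≤ 3e^{π²}.  Along the heavy path of u, k is the maximum of tents of slope 1
-- around the k'(u_j), so the summands 2^{k(u_i)} − 1 add up to at most 4 Σ_j 2^{k'(u_j)};
-- and k' is chosen so that 2^{k'(γ)} ≤ 2^{γ+1}/γ², i.e. each 4·2^{k'} can be paid at rate
-- 16/γ² by the light part T^ℓ of its node, or by all of T_u for the apex itself.  The
-- lg γ successive (1 + γ⁻³)-approximations inflate the sum of the pw of the light children
-- by at most 1 + 2/γ².  A light child has at most half the size of the apex of its heavy
-- path, so its bound W_{m'} has m' < m, and the recurrence for W absorbs the inflation and
-- both charge rates.  The same accounting with the constant 2940 bounds lw(v) by |T^ℓ_v|.

module Submission where

open import Defs
open import Data.Bool using (Bool; true; false; T; if_then_else_)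
open import Data.Product using (_×_; _,_; proj₁; proj₂; uncurry)

module TentSums where

  open import Data.List using (List; []; _∷_; map; foldr; zip; upTo; length)
  open import Data.Nat using (ℕ; zero; suc; pred; _+_; _*_; _∸_; _^_; _≤_; _⊔_; z≤n; s≤s; ∣_-_∣)
  open import Data.Nat.Properties
  open import Data.Nat.Tactic.RingSolver using (solve-∀)
  open import Relation.Binary.PropositionalEquality
  open import Relation.Nullary using (yes; no)
  open import Data.Sum using (inj₁; inj₂)

  sumFrom : ℕ → ℕ → (ℕ → ℕ) → ℕ
  sumFrom a zero    f = 0
  sumFrom a (suc L) f = f a + sumFrom (suc a) L f

  sumFrom-mono : ∀ a L {f g : ℕ → ℕ} → (∀ i → f i ≤ g i) → sumFrom a L f ≤ sumFrom a L g
  sumFrom-mono a zero    f≤g = z≤n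
  sumFrom-mono a (suc L) f≤g = +-mono-≤ (f≤g a) (sumFrom-mono (suc a) L f≤g)

  sumFrom-+ : ∀ a L (f g : ℕ → ℕ) → sumFrom a L (λ i → f i + g i) ≡ sumFrom a L f + sumFrom a L g
  sumFrom-+ a zero    f g = refl
  sumFrom-+ a (suc L) f g = begin
    f a + g a + sumFrom (suc a) L (λ i → f i + g i)
      ≡⟨ cong (f a + g a +_) (sumFrom-+ (suc a) L f g) ⟩
    f a + g a + (sumFrom (suc a) L f + sumFrom (suc a) L g)
      ≡⟨ +-assoc-middle (f a) (g a) (sumFrom (suc a) L f) (sumFrom (suc a) L g) ⟩
    f a + sumFrom (suc a) L f + (g a + sumFrom (suc a) L g) ∎
    where
    open ≡-Reasoning
    +-assoc-middle : ∀ x y z w → x + y + (z + w) ≡ x + z + (y + w)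
    +-assoc-middle = solve-∀

  sumFrom-zero : ∀ a L → sumFrom a L (λ _ → 0) ≡ 0
  sumFrom-zero a zero    = refl
  sumFrom-zero a (suc L) = sumFrom-zero (suc a) L

  tent : ℕ → ℕ → ℕ → ℕ
  tent j k i = 2 ^ (k ∸ ∣ i - j ∣) ∸ 1

  2^n∸1+2*2^[n-1]≤2*2^n : ∀ n → (2 ^ n ∸ 1) + 2 * 2 ^ pred n ≤ 2 * 2 ^ n
  2^n∸1+2*2^[n-1]≤2*2^n zero    = ≤-refl
  2^n∸1+2*2^[n-1]≤2*2^n (suc n) =
    ≤-trans (+-monoˡ-≤ (2 * 2 ^ n) (m∸n≤m (2 ^ suc n) 1)) (≤-reflexive (double (2 ^ n)))
    where
    double : ∀ p → 2 * p + 2 * p ≡ 2 * (2 * p)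
    double = solve-∀

  2*2^[k∸d]≤4*2^k : ∀ k d → 2 * 2 ^ (k ∸ d) ≤ 4 * 2 ^ k
  2*2^[k∸d]≤4*2^k k d = *-mono-≤ {2} {4} (s≤s (s≤s z≤n)) (^-monoʳ-≤ 2 (m∸n≤m k d))

  tent-sum-right : ∀ L a j k → j ≤ a → sumFrom a L (tent j k) ≤ 2 * 2 ^ (k ∸ (a ∸ j))
  tent-sum-right zero    a j k j≤a = z≤n
  tent-sum-right (suc L) a j k j≤a = begin
    (2 ^ (k ∸ ∣ a - j ∣) ∸ 1) + sumFrom (suc a) L (tent j k)
      ≡⟨ cong (λ e → (2 ^ (k ∸ e) ∸ 1) + sumFrom (suc a) L (tent j k)) (m≤n⇒∣n-m∣≡n∸m j≤a) ⟩
    (2 ^ n ∸ 1) + sumFrom (suc a) L (tent j k)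
      ≤⟨ +-monoʳ-≤ (2 ^ n ∸ 1) (tent-sum-right L (suc a) j k (m≤n⇒m≤1+n j≤a)) ⟩
    (2 ^ n ∸ 1) + 2 * 2 ^ (k ∸ (suc a ∸ j))
      ≡⟨ cong (λ e → (2 ^ n ∸ 1) + 2 * 2 ^ e) k∸[1+a∸j]≡n-1 ⟩
    (2 ^ n ∸ 1) + 2 * 2 ^ pred n
      ≤⟨ 2^n∸1+2*2^[n-1]≤2*2^n n ⟩
    2 * 2 ^ n ∎
    where
    open ≤-Reasoning
    n = k ∸ (a ∸ j)
    k∸[1+a∸j]≡n-1 : k ∸ (suc a ∸ j) ≡ pred n
    k∸[1+a∸j]≡n-1 = trans (cong (k ∸_) (+-∸-assoc 1 j≤a)) (sym (pred[m∸n]≡m∸[1+n] k (a ∸ j)))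

  -- The extra summand leaves room for the right half of the tent once the window passes its peak.
  tent-sum-left : ∀ L a j k → a ≤ j → sumFrom a L (tent j k) + 2 * 2 ^ (k ∸ (j ∸ a)) ≤ 4 * 2 ^ k
  tent-sum-left L a j k a≤j with a ≟ j
  ... | yes refl = begin
    sumFrom a L (tent a k) + 2 * 2 ^ (k ∸ (a ∸ a))
      ≤⟨ +-monoˡ-≤ _ (tent-sum-right L a a k ≤-refl) ⟩
    2 * 2 ^ (k ∸ (a ∸ a)) + 2 * 2 ^ (k ∸ (a ∸ a))
      ≡⟨ cong (λ e → 2 * 2 ^ (k ∸ e) + 2 * 2 ^ (k ∸ e)) (n∸n≡0 a) ⟩
    2 * 2 ^ k + 2 * 2 ^ k
      ≡⟨ double (2 ^ k) ⟩
    4 * 2 ^ k ∎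
    where
    open ≤-Reasoning
    double : ∀ p → 2 * p + 2 * p ≡ 4 * p
    double = solve-∀
  ... | no a≢j = go L
    where
    open ≤-Reasoning
    a<j = ≤∧≢⇒< a≤j a≢j
    n = k ∸ (j ∸ suc a)
    k∸[j∸a]≡n-1 : k ∸ (j ∸ a) ≡ pred n
    k∸[j∸a]≡n-1 = trans (cong (k ∸_) (+-∸-assoc 1 a<j)) (sym (pred[m∸n]≡m∸[1+n] k (j ∸ suc a)))
    go : ∀ L → sumFrom a L (tent j k) + 2 * 2 ^ (k ∸ (j ∸ a)) ≤ 4 * 2 ^ k
    go zero    = 2*2^[k∸d]≤4*2^k k (j ∸ a)
    go (suc L) = begin
      tent j k a + sumFrom (suc a) L (tent j k) + 2 * 2 ^ (k ∸ (j ∸ a))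
        ≡⟨ +-assoc-comm (tent j k a) _ _ ⟩
      (2 ^ (k ∸ ∣ a - j ∣) ∸ 1) + 2 * 2 ^ (k ∸ (j ∸ a)) + sumFrom (suc a) L (tent j k)
        ≡⟨ cong₂ (λ d e → (2 ^ d ∸ 1) + 2 * 2 ^ e + sumFrom (suc a) L (tent j k))
                 (trans (cong (k ∸_) (m≤n⇒∣m-n∣≡n∸m a≤j)) k∸[j∸a]≡n-1) k∸[j∸a]≡n-1 ⟩
      (2 ^ pred n ∸ 1) + 2 * 2 ^ pred n + sumFrom (suc a) L (tent j k)
        ≤⟨ +-monoˡ-≤ _ (+-monoˡ-≤ _ (∸-monoˡ-≤ 1 (^-monoʳ-≤ 2 (pred[n]≤n {n})))) ⟩
      (2 ^ n ∸ 1) + 2 * 2 ^ pred n + sumFrom (suc a) L (tent j k)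
        ≤⟨ +-monoˡ-≤ _ (2^n∸1+2*2^[n-1]≤2*2^n n) ⟩
      2 * 2 ^ n + sumFrom (suc a) L (tent j k)
        ≡⟨ +-comm (2 * 2 ^ n) _ ⟩
      sumFrom (suc a) L (tent j k) + 2 * 2 ^ n
        ≤⟨ tent-sum-left L (suc a) j k a<j ⟩
      4 * 2 ^ k ∎
      where
      +-assoc-comm : ∀ x y z → x + y + z ≡ x + z + y
      +-assoc-comm = solve-∀

  tent-sum : ∀ a L j k → sumFrom a L (tent j k) ≤ 4 * 2 ^ k
  tent-sum a L j k with a ≤? j
  ... | yes a≤j = ≤-trans (m≤m+n _ _) (tent-sum-left L a j k a≤j)
  ... | no a≰j  = ≤-trans (tent-sum-right L a j k (<⇒≤ (≰⇒> a≰j)))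
                    (2*2^[k∸d]≤4*2^k k (a ∸ j))

  maxTent : List (ℕ × ℕ) → ℕ → ℕ
  maxTent ps i = foldr (λ p m → (proj₂ p ∸ ∣ i - proj₁ p ∣) ⊔ m) 0 ps

  tents : List (ℕ × ℕ) → ℕ → ℕ
  tents []             i = 0
  tents ((j , k) ∷ ps) i = tent j k i + tents ps i

  2^[m⊔n]∸1≤[2^m∸1]+[2^n∸1] : ∀ m n → 2 ^ (m ⊔ n) ∸ 1 ≤ (2 ^ m ∸ 1) + (2 ^ n ∸ 1)
  2^[m⊔n]∸1≤[2^m∸1]+[2^n∸1] m n with ≤-total m n
  ... | inj₁ m≤n rewrite m≤n⇒m⊔n≡n m≤n = m≤n+m _ _
  ... | inj₂ n≤m rewrite m≥n⇒m⊔n≡m n≤m = m≤m+n _ _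

  2^maxTent∸1≤tents : ∀ ps i → 2 ^ maxTent ps i ∸ 1 ≤ tents ps i
  2^maxTent∸1≤tents []             i = z≤n
  2^maxTent∸1≤tents ((j , k) ∷ ps) i =
    ≤-trans (2^[m⊔n]∸1≤[2^m∸1]+[2^n∸1] (k ∸ ∣ i - j ∣) (maxTent ps i))
            (+-monoʳ-≤ (tent j k i) (2^maxTent∸1≤tents ps i))

  sumPow2 : List ℕ → ℕ
  sumPow2 []       = 0
  sumPow2 (k ∷ ks) = 2 ^ k + sumPow2 ks

  tents-sum : ∀ ps a L → sumFrom a L (tents ps) ≤ 4 * sumPow2 (map proj₂ ps)
  tents-sum []             a L = ≤-reflexive (sumFrom-zero a L)
  tents-sum ((j , k) ∷ ps) a L = begin
    sumFrom a L (tents ((j , k) ∷ ps))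
      ≡⟨ sumFrom-+ a L (tent j k) (tents ps) ⟩
    sumFrom a L (tent j k) + sumFrom a L (tents ps)
      ≤⟨ +-mono-≤ (tent-sum a L j k) (tents-sum ps a L) ⟩
    4 * 2 ^ k + 4 * sumPow2 (map proj₂ ps)
      ≡⟨ *-distribˡ-+ 4 (2 ^ k) (sumPow2 (map proj₂ ps)) ⟨
    4 * sumPow2 (map proj₂ ((j , k) ∷ ps)) ∎
    where open ≤-Reasoning

  sumPow2-zip : ∀ (xs ks : List ℕ) → sumPow2 (map proj₂ (zip xs ks)) ≤ sumPow2 ks
  sumPow2-zip []       ks       = z≤n
  sumPow2-zip (x ∷ xs) []       = z≤n
  sumPow2-zip (x ∷ xs) (k ∷ ks) = +-monoʳ-≤ (2 ^ k) (sumPow2-zip xs ks)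

  -- kAt ks is the maximum of the tents of height k'(u_j) centred at the positions j of the path.
  kAt-sum : ∀ ks a L → sumFrom a L (λ i → 2 ^ kAt ks i ∸ 1) ≤ 4 * sumPow2 ks
  kAt-sum ks a L = begin
    sumFrom a L (λ i → 2 ^ maxTent ps i ∸ 1) ≤⟨ sumFrom-mono a L (2^maxTent∸1≤tents ps) ⟩
    sumFrom a L (tents ps)                   ≤⟨ tents-sum ps a L ⟩
    4 * sumPow2 (map proj₂ ps)               ≤⟨ *-monoʳ-≤ 4 (sumPow2-zip (upTo (length ks)) ks) ⟩
    4 * sumPow2 ks                           ∎
    where
    open ≤-Reasoning
    ps = zip (upTo (length ks)) ks

module Logarithms where

  open import Data.Nat using (zero; suc; _+_; _*_; _∸_; _^_; _≤_; _<_; z≤n; s≤s; ⌊_/2⌋; ⌈_/2⌉)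
  open import Data.Nat.Properties
  open import Data.Nat.Logarithm using (⌊log₂_⌋; ⌈log₂_⌉; ⌊log₂⌋-mono-≤; ⌊log₂[2*b]⌋≡1+⌊log₂b⌋)
  open import Data.Nat.Logarithm.Core using (⌊log2⌋; ⌈log2⌉)
  open import Data.Nat.Induction using (<-wellFounded)
  open import Data.Nat.Tactic.RingSolver using (solve-∀)
  open import Induction.WellFounded using (Acc; acc)
  open import Relation.Binary.PropositionalEquality
  open import Relation.Nullary using (yes; no)

  2^⌊log₂n⌋≤n : ∀ n → 1 ≤ n → 2 ^ ⌊log₂ n ⌋ ≤ n
  2^⌊log₂n⌋≤n n = go n (<-wellFounded n)
    where
    go : ∀ n (rec : Acc _<_ n) → 1 ≤ n → 2 ^ ⌊log2⌋ n rec ≤ n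
    go (suc zero)    _         _ = ≤-refl
    go (suc (suc n)) (acc rec) _ = begin
      2 * 2 ^ ⌊log2⌋ (suc h) _ ≤⟨ *-monoʳ-≤ 2 (go (suc h) _ (s≤s z≤n)) ⟩
      2 * suc h                ≡⟨ double-suc h ⟩
      2 + (h + h)              ≤⟨ +-monoʳ-≤ 2 (+-monoʳ-≤ h (⌊n/2⌋≤⌈n/2⌉ n)) ⟩
      2 + (h + ⌈ n /2⌉)        ≡⟨ cong (2 +_) (⌊n/2⌋+⌈n/2⌉≡n n) ⟩
      2 + n                    ∎
      where
      open ≤-Reasoning
      h = ⌊ n /2⌋
      double-suc : ∀ h → 2 * suc h ≡ 2 + (h + h)
      double-suc = solve-∀

  n≤2^⌈log₂n⌉ : ∀ n → n ≤ 2 ^ ⌈log₂ n ⌉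
  n≤2^⌈log₂n⌉ n = go n (<-wellFounded n)
    where
    go : ∀ n (rec : Acc _<_ n) → n ≤ 2 ^ ⌈log2⌉ n rec
    go zero          _         = z≤n
    go (suc zero)    _         = ≤-refl
    go (suc (suc n)) (acc rec) = begin
      2 + n                    ≡⟨ cong (2 +_) (⌊n/2⌋+⌈n/2⌉≡n n) ⟨
      2 + (⌊ n /2⌋ + c)        ≤⟨ +-monoʳ-≤ 2 (+-monoˡ-≤ c (⌊n/2⌋≤⌈n/2⌉ n)) ⟩
      2 + (c + c)              ≡⟨ double-suc c ⟨
      2 * suc c                ≤⟨ *-monoʳ-≤ 2 (go (suc c) _) ⟩
      2 * 2 ^ ⌈log2⌉ (suc c) _ ∎
      where
      open ≤-Reasoning
      c = ⌈ n /2⌉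
      double-suc : ∀ h → 2 * suc h ≡ 2 + (h + h)
      double-suc = solve-∀

  n<2^n : ∀ n → n < 2 ^ n
  n<2^n zero    = s≤s z≤n
  n<2^n (suc n) = ≤-trans (+-mono-≤ (m^n>0 2 n) (n<2^n n)) (≤-reflexive (cong (2 ^ n +_) (sym (+-identityʳ (2 ^ n)))))

  n*n≤2^[1+n] : ∀ n → n * n ≤ 2 ^ suc n
  n*n≤2^[1+n] zero                = z≤n
  n*n≤2^[1+n] (suc zero)          = s≤s z≤n
  n*n≤2^[1+n] (suc (suc zero))    = s≤s (s≤s (s≤s (s≤s z≤n)))
  n*n≤2^[1+n] (suc (suc (suc n))) = from3 n
    where
    from3 : ∀ n → (3 + n) * (3 + n) ≤ 2 ^ (4 + n)
    from3 zero    = s≤s (s≤s (s≤s (s≤s (s≤s (s≤s (s≤s (s≤s (s≤s z≤n))))))))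
    from3 (suc n) = ≤-trans (m≤m+n _ (n * n + 4 * n + 2)) (≤-trans (≤-reflexive (step n)) (*-monoʳ-≤ 2 (from3 n)))
      where
      step : ∀ n → (4 + n) * (4 + n) + (n * n + 4 * n + 2) ≡ 2 * ((3 + n) * (3 + n))
      step = solve-∀

  flg-pos : ∀ n → 1 ≤ flg n
  flg-pos n = m≤m⊔n 1 ⌊log₂ n ⌋

  flg-mono : ∀ {m n} → m ≤ n → flg m ≤ flg n
  flg-mono m≤n = ⊔-monoʳ-≤ 1 (⌊log₂⌋-mono-≤ m≤n)

  flg[n]≤n : ∀ n → 1 ≤ n → flg n ≤ n
  flg[n]≤n n 1≤n = ⊔-lub 1≤n (<⇒≤ (<-≤-trans (n<2^n ⌊log₂ n ⌋) (2^⌊log₂n⌋≤n n 1≤n)))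

  2^flg[n]≤2*n : ∀ n → 1 ≤ n → 2 ^ flg n ≤ 2 * n
  2^flg[n]≤2*n n 1≤n with ⌊log₂ n ⌋ ≤? 1
  ... | yes log≤1 rewrite m≥n⇒m⊔n≡m log≤1 = *-monoʳ-≤ 2 1≤n
  ... | no  log≰1 rewrite m≤n⇒m⊔n≡n (<⇒≤ (≰⇒> log≰1)) = ≤-trans (2^⌊log₂n⌋≤n n 1≤n) (m≤m+n n (n + 0))

  2^k'[g]*[g*g]≤2^[1+g] : ∀ g → 2 ^ k' g * (g * g) ≤ 2 ^ suc g
  2^k'[g]*[g*g]≤2^[1+g] g with c2lg g ≤? suc g
  ... | yes c≤1+g = begin
    2 ^ (suc g ∸ c2lg g) * (g * g)        ≤⟨ *-monoʳ-≤ (2 ^ (suc g ∸ c2lg g)) g*g≤2^c ⟩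
    2 ^ (suc g ∸ c2lg g) * 2 ^ c2lg g     ≡⟨ ^-distribˡ-+-* 2 (suc g ∸ c2lg g) (c2lg g) ⟨
    2 ^ (suc g ∸ c2lg g + c2lg g)         ≡⟨ cong (2 ^_) (m∸n+n≡m c≤1+g) ⟩
    2 ^ suc g                             ∎
    where
    open ≤-Reasoning
    g*g≤2^c : g * g ≤ 2 ^ c2lg g
    g*g≤2^c = ≤-trans (n≤2^⌈log₂n⌉ (g * g)) (^-monoʳ-≤ 2 (m≤n⊔m 2 ⌈log₂ (g * g) ⌉))
  ... | no c≰1+g rewrite m≤n⇒m∸n≡0 (<⇒≤ (≰⇒> c≰1+g)) = ≤-trans (≤-reflexive (+-identityʳ (g * g))) (n*n≤2^[1+n] g)

  2^k'[γ]*γ²≤4*n : ∀ n → 1 ≤ n → 2 ^ k' (flg n) * (flg n * flg n) ≤ 4 * n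
  2^k'[γ]*γ²≤4*n n 1≤n = begin
    2 ^ k' (flg n) * (flg n * flg n) ≤⟨ 2^k'[g]*[g*g]≤2^[1+g] (flg n) ⟩
    2 * 2 ^ flg n                    ≤⟨ *-monoʳ-≤ 2 (2^flg[n]≤2*n n 1≤n) ⟩
    2 * (2 * n)                      ≡⟨ *-assoc 2 2 n ⟨
    4 * n                            ∎
    where open ≤-Reasoning

  1+⌊log₂m⌋≤⌊log₂n⌋ : ∀ {m n} → 1 ≤ m → 2 * m ≤ n → suc ⌊log₂ m ⌋ ≤ ⌊log₂ n ⌋
  1+⌊log₂m⌋≤⌊log₂n⌋ {suc m} {n} _ 2m≤n = subst (_≤ ⌊log₂ n ⌋) (⌊log₂[2*b]⌋≡1+⌊log₂b⌋ (suc m)) (⌊log₂⌋-mono-≤ 2m≤n)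

  n<flg[g]⇒2*n≤g^3 : ∀ {g n} → 1 ≤ g → n < flg g → 2 * n ≤ g ^ 3
  n<flg[g]⇒2*n≤g^3 {suc zero}    {zero}  _ _         = z≤n
  n<flg[g]⇒2*n≤g^3 {suc zero}    {suc n} _ (s≤s ())
  n<flg[g]⇒2*n≤g^3 {suc (suc g)} {n}     _ n<flg[g] = begin
    2 * n                  ≤⟨ *-monoʳ-≤ 2 (<⇒≤ (<-≤-trans n<flg[g] (flg[n]≤n G (s≤s z≤n)))) ⟩
    2 * G                  ≤⟨ *-monoˡ-≤ G {2} {G} (s≤s (s≤s z≤n)) ⟩
    G * G                  ≤⟨ *-monoʳ-≤ G (m≤m*n G (G * 1)) ⟩
    G * (G * (G * 1))      ∎
    where
    open ≤-Reasoning
    G = suc (suc g)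

  flg[g]*[g*g]≤g^3 : ∀ g → 1 ≤ g → flg g * (g * g) ≤ g ^ 3
  flg[g]*[g*g]≤g^3 g 1≤g = ≤-trans (*-monoˡ-≤ (g * g) (flg[n]≤n g 1≤g)) (≤-reflexive (cong (λ x → g * (g * x)) (sym (*-identityʳ g))))

module RationalEmbedding where

  open import Data.Nat as ℕ using (ℕ; zero; suc)
  import Data.Nat.Properties as ℕ
  open import Data.Integer as ℤ using (+_)
  import Data.Integer.Properties as ℤ
  import Data.Integer.Tactic.RingSolver as ℤ-Solver
  open import Data.Rational using (ℚ; 0ℚ; 1ℚ; _+_; _*_; _≤_; _<_; toℚᵘ; *≤*; nonNegative; positive)
  open import Data.Rational.Properties
  import Data.Rational.Unnormalised as U
  import Data.Rational.Unnormalised.Properties as U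
  open import Data.Rational.Solver using (module +-*-Solver)
  open import Relation.Binary.PropositionalEquality
  open +-*-Solver

  toℚᵘ-fromℕ : ∀ n → toℚᵘ (fromℕ n) U.≃ U.mkℚᵘ (+ n) 0
  toℚᵘ-fromℕ n = toℚᵘ-fromℚᵘ (U.mkℚᵘ (+ n) 0)

  toℚᵘ-inv : ∀ n → toℚᵘ (inv (suc n)) U.≃ U.mkℚᵘ (+ 1) n
  toℚᵘ-inv n = toℚᵘ-fromℚᵘ (U.mkℚᵘ (+ 1) n)

  fromℕ-+ : ∀ m n → fromℕ (m ℕ.+ n) ≡ fromℕ m + fromℕ n
  fromℕ-+ m n = toℚᵘ-injective (U.≃-trans (toℚᵘ-fromℕ (m ℕ.+ n)) (U.≃-sym (U.≃-trans (toℚᵘ-homo-+ (fromℕ m) (fromℕ n))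
    (U.≃-trans (U.+-cong (toℚᵘ-fromℕ m) (toℚᵘ-fromℕ n)) (U.*≡* cross)))))
    where
    cross : (+ m ℤ.* + 1 ℤ.+ + n ℤ.* + 1) ℤ.* + 1 ≡ + (m ℕ.+ n) ℤ.* (+ 1 ℤ.* + 1)
    cross = trans (ℤ-identity (+ m) (+ n)) (cong (ℤ._* (+ 1 ℤ.* + 1)) (sym (ℤ.pos-+ m n)))
      where
      ℤ-identity : ∀ x y → (x ℤ.* + 1 ℤ.+ y ℤ.* + 1) ℤ.* + 1 ≡ (x ℤ.+ y) ℤ.* (+ 1 ℤ.* + 1)
      ℤ-identity = ℤ-Solver.solve-∀

  fromℕ-* : ∀ m n → fromℕ (m ℕ.* n) ≡ fromℕ m * fromℕ n
  fromℕ-* m n = toℚᵘ-injective (U.≃-trans (toℚᵘ-fromℕ (m ℕ.* n)) (U.≃-sym (U.≃-trans (toℚᵘ-homo-* (fromℕ m) (fromℕ n))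
    (U.≃-trans (U.*-cong (toℚᵘ-fromℕ m) (toℚᵘ-fromℕ n)) (U.*≡* cross)))))
    where
    cross : (+ m ℤ.* + n) ℤ.* + 1 ≡ + (m ℕ.* n) ℤ.* (+ 1 ℤ.* + 1)
    cross = trans (ℤ-identity (+ m) (+ n)) (cong (ℤ._* (+ 1 ℤ.* + 1)) (sym (ℤ.pos-* m n)))
      where
      ℤ-identity : ∀ x y → (x ℤ.* y) ℤ.* + 1 ≡ (x ℤ.* y) ℤ.* (+ 1 ℤ.* + 1)
      ℤ-identity = ℤ-Solver.solve-∀

  fromℕ*inv≡1 : ∀ n → fromℕ (suc n) * inv (suc n) ≡ 1ℚ
  fromℕ*inv≡1 n = toℚᵘ-injective (U.≃-trans (toℚᵘ-homo-* (fromℕ (suc n)) (inv (suc n)))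
    (U.≃-trans (U.*-cong (toℚᵘ-fromℕ (suc n)) (toℚᵘ-inv n)) (U.*≡* (ℤ-identity (+ suc n)))))
    where
    ℤ-identity : ∀ x → (x ℤ.* + 1) ℤ.* + 1 ≡ + 1 ℤ.* (+ 1 ℤ.* x)
    ℤ-identity = ℤ-Solver.solve-∀

  fromℕ-mono : ∀ {m n} → m ℕ.≤ n → fromℕ m ≤ fromℕ n
  fromℕ-mono {m} {n} m≤n = toℚᵘ-cancel-≤ (U.≤-respʳ-≃ (U.≃-sym (toℚᵘ-fromℕ n)) (U.≤-respˡ-≃ (U.≃-sym (toℚᵘ-fromℕ m))
    (U.*≤* (ℤ.*-monoʳ-≤-nonNeg (+ 1) (ℤ.+≤+ m≤n)))))

  0≤fromℕ : ∀ n → 0ℚ ≤ fromℕ n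
  0≤fromℕ n = fromℕ-mono {0} {n} ℕ.z≤n

  0<fromℕ-suc : ∀ n → 0ℚ < fromℕ (suc n)
  0<fromℕ-suc n = toℚᵘ-cancel-< (U.<-respʳ-≃ (U.≃-sym (toℚᵘ-fromℕ (suc n))) (U.*<* (ℤ.+<+ (ℕ.s≤s ℕ.z≤n))))

  0≤inv : ∀ n → 0ℚ ≤ inv n
  0≤inv zero    = ≤-refl
  0≤inv (suc n) = toℚᵘ-cancel-≤ (U.≤-respʳ-≃ (U.≃-sym (toℚᵘ-inv n)) (U.*≤* (ℤ.+≤+ ℕ.z≤n)))

  *-monoˡ-≤-0≤ : ∀ {r p q} → 0ℚ ≤ r → p ≤ q → r * p ≤ r * q
  *-monoˡ-≤-0≤ {r} 0≤r = *-monoˡ-≤-nonNeg r {{nonNegative 0≤r}}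

  *-monoʳ-≤-0≤ : ∀ {r p q} → 0ℚ ≤ r → p ≤ q → p * r ≤ q * r
  *-monoʳ-≤-0≤ {r} 0≤r = *-monoʳ-≤-nonNeg r {{nonNegative 0≤r}}

  *-mono-≤-0≤ : ∀ {p q r s} → 0ℚ ≤ q → 0ℚ ≤ r → p ≤ q → r ≤ s → p * r ≤ q * s
  *-mono-≤-0≤ 0≤q 0≤r p≤q r≤s = ≤-trans (*-monoʳ-≤-0≤ 0≤r p≤q) (*-monoˡ-≤-0≤ 0≤q r≤s)

  0≤* : ∀ {p q} → 0ℚ ≤ p → 0ℚ ≤ q → 0ℚ ≤ p * q
  0≤* {p} {q} 0≤p 0≤q = subst (_≤ p * q) (*-zeroˡ q) (*-monoʳ-≤-0≤ 0≤q 0≤p)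

  0≤+ : ∀ {p q} → 0ℚ ≤ p → 0ℚ ≤ q → 0ℚ ≤ p + q
  0≤+ = +-mono-≤

  p≤p+q : ∀ p {q} → 0ℚ ≤ q → p ≤ p + q
  p≤p+q p {q} 0≤q = subst (_≤ p + q) (+-identityʳ p) (+-monoʳ-≤ p 0≤q)

  *-cancelʳ-≤-fromℕ-suc : ∀ n {p q} → p * fromℕ (suc n) ≤ q * fromℕ (suc n) → p ≤ q
  *-cancelʳ-≤-fromℕ-suc n = *-cancelʳ-≤-pos (fromℕ (suc n)) {{positive (0<fromℕ-suc n)}}

  fromℕ*inv-≤ : ∀ a b c d → a ℕ.* suc d ℕ.≤ c ℕ.* suc b → fromℕ a * inv (suc b) ≤ fromℕ c * inv (suc d)
  fromℕ*inv-≤ a b c d cross = *-cancelʳ-≤-fromℕ-suc (b ℕ.+ d ℕ.* suc b)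
    (≤-trans (≤-reflexive (clear a b d)) (≤-trans (fromℕ-mono cross) (≤-reflexive (sym (trans (cong (λ x → fromℕ c * inv (suc d) * fromℕ x) (ℕ.*-comm (suc d) (suc b))) (clear c d b))))))
    where
    open ≡-Reasoning
    clear : ∀ a b d → fromℕ a * inv (suc b) * fromℕ (suc d ℕ.* suc b) ≡ fromℕ (a ℕ.* suc d)
    clear a b d = begin
      fromℕ a * inv (suc b) * fromℕ (suc d ℕ.* suc b)          ≡⟨ cong (fromℕ a * inv (suc b) *_) (fromℕ-* (suc d) (suc b)) ⟩
      fromℕ a * inv (suc b) * (fromℕ (suc d) * fromℕ (suc b))  ≡⟨ solve 4 (λ x y z w → x :* y :* (z :* w) := x :* z :* (w :* y)) refl
                                                                     (fromℕ a) (inv (suc b)) (fromℕ (suc d)) (fromℕ (suc b)) ⟩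
      fromℕ a * fromℕ (suc d) * (fromℕ (suc b) * inv (suc b))  ≡⟨ cong (fromℕ a * fromℕ (suc d) *_) (fromℕ*inv≡1 b) ⟩
      fromℕ a * fromℕ (suc d) * 1ℚ                              ≡⟨ *-identityʳ _ ⟩
      fromℕ a * fromℕ (suc d)                                   ≡⟨ fromℕ-* a (suc d) ⟨
      fromℕ (a ℕ.* suc d)                                       ∎

open import Data.Bool.Properties using (T-≡)
open import Data.Empty using (⊥-elim)
open import Data.List using (List; []; _∷_; length)
open import Data.List.Relation.Unary.All as All using (All; []; _∷_)
open import Data.Nat as ℕ using (ℕ; zero; suc; _^_; _⊔_)
import Data.Nat.Properties as ℕ
open import Data.Nat.Logarithm using (⌊log₂_⌋)
open import Data.Nat.Tactic.RingSolver using (solve-∀)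
open import Data.Rational using (ℚ; 0ℚ; 1ℚ; _+_; _*_; _≤_; _<_)
open import Data.Rational.Properties
open import Data.Rational.Solver using (module +-*-Solver)
open import Data.Sum using (inj₁; inj₂)
open import Data.Unit using (tt)
open import Function.Bundles using (Equivalence)
open import Relation.Binary.PropositionalEquality

open +-*-Solver
open TentSums using (sumFrom; sumPow2; kAt-sum)
open Logarithms
open RationalEmbedding

invSq : ℕ → ℚ
invSq q = inv (q ℕ.* q)

-- The factor by which the (1 + γ⁻³)-approximations can inflate the light weight of a node.
κ : ℕ → ℚ
κ q = 1ℚ + fromℕ 2 * invSq q

0≤invSq : ∀ q → 0ℚ ≤ invSq q
0≤invSq q = 0≤inv (q ℕ.* q)

invSq-anti : ∀ {p q} → 1 ℕ.≤ p → p ℕ.≤ q → invSq q ≤ invSq p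
invSq-anti {suc p} {suc q} _ p≤q = subst₂ _≤_ (*-identityˡ _) (*-identityˡ _)
  (fromℕ*inv-≤ 1 (q ℕ.+ q ℕ.* suc q) 1 (p ℕ.+ p ℕ.* suc p) (ℕ.*-monoʳ-≤ 1 (ℕ.*-mono-≤ p≤q p≤q)))

invSq≤1 : ∀ {q} → 1 ℕ.≤ q → invSq q ≤ 1ℚ
invSq≤1 1≤q = invSq-anti ℕ.≤-refl 1≤q

1≤κ : ∀ q → 1ℚ ≤ κ q
1≤κ q = p≤p+q 1ℚ (0≤* (0≤fromℕ 2) (0≤invSq q))

0≤κ : ∀ q → 0ℚ ≤ κ q
0≤κ q = ≤-trans (0≤fromℕ 1) (1≤κ q)

-- pw(u) ≤ W ⌊log₂ |T_u|⌋ · |T_u| for apex nodes u.  The 32/q² pays for two charge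
-- rates 16/γ², and W 0 = 33 also covers the summand 1 of lw.
W : ℕ → ℚ
W zero    = fromℕ 33
W (suc m) = κ (1 ⊔ m) * W m + fromℕ 32 * invSq (1 ⊔ m)

W-step : ∀ m → 0ℚ ≤ W m → W m ≤ W (suc m)
W-step m 0≤Wm = ≤-trans (subst (_≤ κ (1 ⊔ m) * W m) (*-identityˡ (W m)) (*-monoʳ-≤-0≤ 0≤Wm (1≤κ (1 ⊔ m))))
                        (p≤p+q _ (0≤* (0≤fromℕ 32) (0≤invSq (1 ⊔ m))))

33≤W : ∀ m → fromℕ 33 ≤ W m
33≤W zero    = ≤-refl
33≤W (suc m) = ≤-trans (33≤W m) (W-step m (≤-trans (0≤fromℕ 33) (33≤W m)))

0≤W : ∀ m → 0ℚ ≤ W m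
0≤W m = ≤-trans (0≤fromℕ 33) (33≤W m)

W-mono : ∀ {m n} → m ℕ.≤ n → W m ≤ W n
W-mono {m} {n} m≤n = subst (λ n → W m ≤ W n) (ℕ.m∸n+n≡m m≤n) (W≤W[k+m] (n ℕ.∸ m))
  where
  W≤W[k+m] : ∀ k → W m ≤ W (k ℕ.+ m)
  W≤W[k+m] zero    = ≤-refl
  W≤W[k+m] (suc k) = ≤-trans (W≤W[k+m] k) (W-step (k ℕ.+ m) (0≤W (k ℕ.+ m)))

-- V = W + 16 is a plain product of the factors κ, which telescopes against (5n+1)/(n+4).
V : ℕ → ℚ
V m = W m + fromℕ 16

V-step : ∀ m → V (suc m) ≡ κ (1 ⊔ m) * V m
V-step m = solve 2 (λ w x → (con 1ℚ :+ con (fromℕ 2) :* x) :* w :+ con (fromℕ 32) :* x :+ con (fromℕ 16)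
                         := (con 1ℚ :+ con (fromℕ 2) :* x) :* (w :+ con (fromℕ 16))) refl (W m) (invSq (1 ⊔ m))

V[1+n]*[4+n]≤588*[5n+1] : ∀ n → V (suc n) * fromℕ (4 ℕ.+ n) ≤ fromℕ (588 ℕ.* (5 ℕ.* n ℕ.+ 1))
V[1+n]*[4+n]≤588*[5n+1] zero    = ≤ᵇ⇒≤ tt
V[1+n]*[4+n]≤588*[5n+1] (suc n) = *-cancelʳ-≤-fromℕ-suc (ℕ.pred (qq ℕ.* (4 ℕ.+ n))) (begin
    V (suc (suc n)) * B * fromℕ (qq ℕ.* (4 ℕ.+ n))
  ≡⟨ cong₂ (λ x y → x * B * y) (V-step (suc n)) (fromℕ-* qq (4 ℕ.+ n)) ⟩
    κ q * Vn * B * (Q * A)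
  ≡⟨ solve 5 (λ k v b qq a → k :* v :* b :* (qq :* a) := (qq :* k) :* b :* (v :* a)) refl (κ q) Vn B Q A ⟩
    (Q * κ q) * B * (Vn * A)
  ≡⟨ cong (λ x → x * B * (Vn * A)) Q*κq≡q²+2 ⟩
    fromℕ (qq ℕ.+ 2) * B * (Vn * A)
  ≤⟨ *-monoˡ-≤-0≤ (0≤* (0≤fromℕ (qq ℕ.+ 2)) (0≤fromℕ (5 ℕ.+ n))) (V[1+n]*[4+n]≤588*[5n+1] n) ⟩
    fromℕ (qq ℕ.+ 2) * B * C
  ≡⟨ trans (fromℕ-* ((qq ℕ.+ 2) ℕ.* (5 ℕ.+ n)) (588 ℕ.* (5 ℕ.* n ℕ.+ 1))) (cong (_* C) (fromℕ-* (qq ℕ.+ 2) (5 ℕ.+ n))) ⟨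
    fromℕ ((qq ℕ.+ 2) ℕ.* (5 ℕ.+ n) ℕ.* (588 ℕ.* (5 ℕ.* n ℕ.+ 1)))
  ≤⟨ fromℕ-mono ratio-step ⟩
    fromℕ ((588 ℕ.* (5 ℕ.* suc n ℕ.+ 1)) ℕ.* (qq ℕ.* (4 ℕ.+ n)))
  ≡⟨ fromℕ-* (588 ℕ.* (5 ℕ.* suc n ℕ.+ 1)) (qq ℕ.* (4 ℕ.+ n)) ⟩
    fromℕ (588 ℕ.* (5 ℕ.* suc n ℕ.+ 1)) * fromℕ (qq ℕ.* (4 ℕ.+ n))
  ∎)
  where
  open ≤-Reasoning
  q = suc n
  qq = q ℕ.* q
  Vn = V (suc n)
  Q = fromℕ qq
  A = fromℕ (4 ℕ.+ n)
  B = fromℕ (5 ℕ.+ n)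
  C = fromℕ (588 ℕ.* (5 ℕ.* n ℕ.+ 1))
  Q*κq≡q²+2 : Q * κ q ≡ fromℕ (qq ℕ.+ 2)
  Q*κq≡q²+2 = begin-equality
    Q * (1ℚ + fromℕ 2 * invSq q)        ≡⟨ solve 2 (λ x y → x :* (con 1ℚ :+ con (fromℕ 2) :* y) := x :+ con (fromℕ 2) :* (x :* y)) refl Q (invSq q) ⟩
    Q + fromℕ 2 * (Q * invSq q)         ≡⟨ cong (λ z → Q + fromℕ 2 * z) (fromℕ*inv≡1 (n ℕ.+ n ℕ.* suc n)) ⟩
    Q + fromℕ 2 * 1ℚ                    ≡⟨ fromℕ-+ qq 2 ⟨
    fromℕ (qq ℕ.+ 2)                    ∎
  14n≤9n²+9 : ∀ n → 14 ℕ.* n ℕ.≤ 9 ℕ.* (n ℕ.* n) ℕ.+ 9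
  14n≤9n²+9 zero          = ℕ.z≤n
  14n≤9n²+9 (suc zero)    = ℕ.≤ᵇ⇒≤ 14 18 tt
  14n≤9n²+9 (suc (suc m)) = ℕ.≤-trans (ℕ.m≤m+n _ (17 ℕ.+ 22 ℕ.* m ℕ.+ 9 ℕ.* (m ℕ.* m))) (ℕ.≤-reflexive (expand m))
    where
    expand : ∀ m → 14 ℕ.* (2 ℕ.+ m) ℕ.+ (17 ℕ.+ 22 ℕ.* m ℕ.+ 9 ℕ.* (m ℕ.* m)) ≡ 9 ℕ.* ((2 ℕ.+ m) ℕ.* (2 ℕ.+ m)) ℕ.+ 9
    expand = solve-∀
  ratio-step : (qq ℕ.+ 2) ℕ.* (5 ℕ.+ n) ℕ.* (588 ℕ.* (5 ℕ.* n ℕ.+ 1)) ℕ.≤ (588 ℕ.* (5 ℕ.* suc n ℕ.+ 1)) ℕ.* (qq ℕ.* (4 ℕ.+ n))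
  ratio-step = ℕ.+-cancelʳ-≤ (588 ℕ.* (14 ℕ.* n)) _ _
    (ℕ.≤-trans (ℕ.+-monoʳ-≤ ((qq ℕ.+ 2) ℕ.* (5 ℕ.+ n) ℕ.* (588 ℕ.* (5 ℕ.* n ℕ.+ 1))) (ℕ.*-monoʳ-≤ 588 (14n≤9n²+9 n)))
               (ℕ.≤-reflexive (expand n)))
    where
    expand : ∀ n → ((1 ℕ.+ n) ℕ.* (1 ℕ.+ n) ℕ.+ 2) ℕ.* (5 ℕ.+ n) ℕ.* (588 ℕ.* (5 ℕ.* n ℕ.+ 1)) ℕ.+ 588 ℕ.* (9 ℕ.* (n ℕ.* n) ℕ.+ 9)
                 ≡ (588 ℕ.* (5 ℕ.* (1 ℕ.+ n) ℕ.+ 1)) ℕ.* (((1 ℕ.+ n) ℕ.* (1 ℕ.+ n)) ℕ.* (4 ℕ.+ n)) ℕ.+ 588 ℕ.* (14 ℕ.* n)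
    expand = solve-∀

W≤2940 : ∀ m → W m ≤ fromℕ 2940
W≤2940 zero    = ≤ᵇ⇒≤ tt
W≤2940 (suc n) = ≤-trans (p≤p+q (W (suc n)) (0≤fromℕ 16)) (*-cancelʳ-≤-fromℕ-suc (3 ℕ.+ n) (begin
  V (suc n) * fromℕ (4 ℕ.+ n)             ≤⟨ V[1+n]*[4+n]≤588*[5n+1] n ⟩
  fromℕ (588 ℕ.* (5 ℕ.* n ℕ.+ 1))         ≤⟨ fromℕ-mono (ℕ.*-monoʳ-≤ 588 (ℕ.+-monoʳ-≤ (5 ℕ.* n) (ℕ.s≤s (ℕ.z≤n {19})))) ⟩
  fromℕ (588 ℕ.* (5 ℕ.* n ℕ.+ 20))        ≡⟨ cong fromℕ (regroup n) ⟩
  fromℕ (2940 ℕ.* (4 ℕ.+ n))              ≡⟨ fromℕ-* 2940 (4 ℕ.+ n) ⟩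
  fromℕ 2940 * fromℕ (4 ℕ.+ n)            ∎))
  where
  open ≤-Reasoning
  regroup : ∀ n → 588 ℕ.* (5 ℕ.* n ℕ.+ 20) ≡ 2940 ℕ.* (4 ℕ.+ n)
  regroup = solve-∀

partialSum : (ℕ → ℚ) → ℕ → ℚ
partialSum B zero    = 0ℚ
partialSum B (suc n) = partialSum B n + B (suc n)

partialSum-+ : ∀ (f g : ℕ → ℚ) n → partialSum (λ i → f i + g i) n ≡ partialSum f n + partialSum g n
partialSum-+ f g zero    = refl
partialSum-+ f g (suc n) = trans (cong (_+ (f (suc n) + g (suc n))) (partialSum-+ f g n))
  (solve 4 (λ a b c d → a :+ b :+ (c :+ d) := a :+ c :+ (b :+ d)) refl (partialSum f n) (partialSum g n) (f (suc n)) (g (suc n)))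

0≤partialSum : ∀ {B} → (∀ i → 0ℚ ≤ B i) → ∀ n → 0ℚ ≤ partialSum B n
0≤partialSum 0≤B zero    = ≤-refl
0≤partialSum 0≤B (suc n) = 0≤+ (0≤partialSum 0≤B n) (0≤B (suc n))

spike : ℕ → ℚ → ℕ → ℚ
spike c p i = if c ℕ.≡ᵇ i then p else 0ℚ

0≤spike : ∀ c {p} → 0ℚ ≤ p → ∀ i → 0ℚ ≤ spike c p i
0≤spike c 0≤p i with c ℕ.≡ᵇ i
... | true  = 0≤p
... | false = ≤-refl

partialSum-spike-below : ∀ c p n → n ℕ.< c → partialSum (spike c p) n ≡ 0ℚ
partialSum-spike-below c p zero    _   = refl
partialSum-spike-below c p (suc n) n<c with c ℕ.≡ᵇ suc n in eq
... | true  = ⊥-elim (ℕ.<-irrefl (sym (ℕ.≡ᵇ⇒≡ c (suc n) (subst T (sym eq) tt))) n<c)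
... | false = trans (+-identityʳ _) (partialSum-spike-below c p n (ℕ.<-trans (ℕ.n<1+n n) n<c))

partialSum-spike≤ : ∀ c {p} → 0ℚ ≤ p → ∀ n → partialSum (spike c p) n ≤ p
partialSum-spike≤ c     0≤p zero    = 0≤p
partialSum-spike≤ c {p} 0≤p (suc n) with c ℕ.≡ᵇ suc n in eq
... | true  rewrite ℕ.≡ᵇ⇒≡ c (suc n) (subst T (sym eq) tt) =
  ≤-reflexive (trans (cong (_+ p) (partialSum-spike-below (suc n) p n (ℕ.n<1+n n))) (+-identityˡ p))
... | false = ≤-trans (≤-reflexive (+-identityʳ _)) (partialSum-spike≤ c 0≤p n)

sumPw : List (HTree Oracle) → ℚ
sumPw []       = 0ℚ
sumPw (l ∷ ls) = pw l + sumPw ls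

0≤bsum : ∀ {ls} → All (λ l → 0ℚ ≤ pw l) ls → ∀ i → 0ℚ ≤ bsum i ls
0≤bsum []             i = ≤-refl
0≤bsum {l ∷ _} (0≤pw ∷ 0≤pws) i = 0≤+ (0≤spike (wc true l) 0≤pw i) (0≤bsum 0≤pws i)

-- Each light child is counted in at most one of the b_i.
partialSum-bsum≤sumPw : ∀ {ls} → All (λ l → 0ℚ ≤ pw l) ls → ∀ n → partialSum (λ i → bsum i ls) n ≤ sumPw ls
partialSum-bsum≤sumPw {[]}     []             zero    = ≤-refl
partialSum-bsum≤sumPw {[]}     []             (suc n) = ≤-trans (≤-reflexive (+-identityʳ _)) (partialSum-bsum≤sumPw [] n)
partialSum-bsum≤sumPw {l ∷ ls} (0≤pw ∷ 0≤pws) n =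
  ≤-trans (≤-reflexive (partialSum-+ (spike (wc true l) (pw l)) (λ i → bsum i ls) n))
          (+-mono-≤ (partialSum-spike≤ (wc true l) 0≤pw n) (partialSum-bsum≤sumPw 0≤pws n))

approx-bound : ∀ {ε x y} → 0ℚ ≤ x → IsApprox ε x y → 0ℚ ≤ y × y ≤ (1ℚ + ε) * x
approx-bound {ε} 0≤x (inj₁ (refl , refl)) = ≤-refl , ≤-reflexive (sym (*-zeroʳ (1ℚ + ε)))
approx-bound     0≤x (inj₂ (x≤y , y<))    = ≤-trans 0≤x x≤y , <⇒≤ y<

compound : ℕ → ℚ → ℚ
compound n ε = 1ℚ + fromℕ (2 ℕ.* n) * ε

1≤compound : ∀ n {ε} → 0ℚ ≤ ε → 1ℚ ≤ compound n ε
1≤compound n 0≤ε = p≤p+q 1ℚ (0≤* (0≤fromℕ (2 ℕ.* n)) 0≤ε)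

compound-step : ∀ n {ε} → 0ℚ ≤ ε → fromℕ (2 ℕ.* n) * ε ≤ 1ℚ → (1ℚ + ε) * compound n ε ≤ compound (suc n) ε
compound-step n {ε} 0≤ε 2nε≤1 = begin
  (1ℚ + ε) * (1ℚ + t * ε)          ≡⟨ solve 2 (λ t e → (con 1ℚ :+ e) :* (con 1ℚ :+ t :* e) := con 1ℚ :+ t :* e :+ e :+ (t :* e) :* e) refl t ε ⟩
  1ℚ + t * ε + ε + (t * ε) * ε     ≤⟨ +-monoʳ-≤ (1ℚ + t * ε + ε) (*-monoʳ-≤-0≤ 0≤ε 2nε≤1) ⟩
  1ℚ + t * ε + ε + 1ℚ * ε          ≡⟨ solve 2 (λ t e → con 1ℚ :+ t :* e :+ e :+ con 1ℚ :* e := con 1ℚ :+ (con (fromℕ 2) :+ t) :* e) refl t ε ⟩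
  1ℚ + (fromℕ 2 + t) * ε           ≡⟨ cong (λ z → 1ℚ + z * ε) (trans (cong fromℕ (ℕ.*-suc 2 n)) (fromℕ-+ 2 (2 ℕ.* n))) ⟨
  compound (suc n) ε               ∎
  where
  open ≤-Reasoning
  t = fromℕ (2 ℕ.* n)

2n/g³≤1 : ∀ {g n} → 1 ℕ.≤ g → n ℕ.< flg g → fromℕ (2 ℕ.* n) * inv (g ^ 3) ≤ 1ℚ
2n/g³≤1 {suc g} {n} 1≤g n<flg = fromℕ*inv-≤ (2 ℕ.* n) (ℕ.pred (suc g ^ 3)) 1 0
  (ℕ.≤-trans (ℕ.≤-reflexive (ℕ.*-identityʳ (2 ℕ.* n))) (ℕ.≤-trans (n<flg[g]⇒2*n≤g^3 1≤g n<flg) (ℕ.≤-reflexive (sym (ℕ.*-identityˡ _)))))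

iterA-bound : ∀ {g α} → 1 ℕ.≤ g → GoodOracle g α → ∀ {B} → (∀ i → 0ℚ ≤ B i) → ∀ n → n ℕ.≤ flg g →
              0ℚ ≤ iterA α B n × iterA α B n ≤ compound n (inv (g ^ 3)) * partialSum B n
iterA-bound {g} 1≤g good 0≤B zero    _ = ≤-refl , ≤-reflexive (sym (*-zeroʳ (compound 0 (inv (g ^ 3)))))
iterA-bound {g} {α} 1≤g good {B} 0≤B (suc n) 1+n≤flg = proj₁ approx , (begin
  α (suc n) x                                  ≤⟨ proj₂ approx ⟩
  (1ℚ + ε) * x                                 ≤⟨ *-monoˡ-≤-0≤ (0≤+ (0≤fromℕ 1) 0≤ε) (+-mono-≤ (proj₂ ih) B≤cB) ⟩
  (1ℚ + ε) * (c * partialSum B n + c * Bn)     ≡⟨ solve 4 (λ e c s b → (con 1ℚ :+ e) :* (c :* s :+ c :* b) := ((con 1ℚ :+ e) :* c) :* (s :+ b))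
                                                        refl ε c (partialSum B n) Bn ⟩
  ((1ℚ + ε) * c) * partialSum B (suc n)        ≤⟨ *-monoʳ-≤-0≤ (0≤partialSum 0≤B (suc n)) (compound-step n 0≤ε 2nε≤1) ⟩
  compound (suc n) ε * partialSum B (suc n)    ∎)
  where
  open ≤-Reasoning
  ε = inv (g ^ 3)
  0≤ε = 0≤inv (g ^ 3)
  c = compound n ε
  Bn = B (suc n)
  ih : 0ℚ ≤ iterA α B n × iterA α B n ≤ c * partialSum B n
  ih = iterA-bound 1≤g good 0≤B n (ℕ.<⇒≤ 1+n≤flg)
  x = iterA α B n + Bn
  0≤x = 0≤+ (proj₁ ih) (0≤B (suc n))
  approx : 0ℚ ≤ α (suc n) x × α (suc n) x ≤ (1ℚ + ε) * x
  approx = approx-bound {ε} 0≤x (good (suc n) x (ℕ.s≤s ℕ.z≤n) 1+n≤flg 0≤x)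
  B≤cB : Bn ≤ c * Bn
  B≤cB = subst (_≤ c * Bn) (*-identityˡ Bn) (*-monoʳ-≤-0≤ (0≤B (suc n)) (1≤compound n 0≤ε))
  2nε≤1 : fromℕ (2 ℕ.* n) * ε ≤ 1ℚ
  2nε≤1 = 2n/g³≤1 1≤g 1+n≤flg

compound≤κ : ∀ g → 1 ℕ.≤ g → compound (flg g) (inv (g ^ 3)) ≤ κ g
compound≤κ (suc g) 1≤g = +-monoʳ-≤ 1ℚ (fromℕ*inv-≤ (2 ℕ.* flg (suc g)) (ℕ.pred (suc g ^ 3)) 2 (ℕ.pred (suc g ℕ.* suc g))
  (ℕ.≤-trans (ℕ.≤-reflexive (ℕ.*-assoc 2 (flg (suc g)) _)) (ℕ.*-monoʳ-≤ 2 (flg[g]*[g*g]≤g^3 (suc g) 1≤g))))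

lightWeight : Oracle → List (HTree Oracle) → ℕ → ℚ
lightWeight α ls g = 1ℚ + iterA α (λ i → bsum i ls) (flg g)

lightWeight-bound : ∀ {g α ls} → 1 ℕ.≤ g → GoodOracle g α → All (λ l → 0ℚ ≤ pw l) ls →
                    0ℚ ≤ lightWeight α ls g × lightWeight α ls g ≤ 1ℚ + κ g * sumPw ls
lightWeight-bound {g} {α} {ls} 1≤g good 0≤pws =
  0≤+ (0≤fromℕ 1) (proj₁ it) ,
  +-monoʳ-≤ 1ℚ (≤-trans (proj₂ it) (*-mono-≤-0≤ (0≤κ g) (0≤partialSum (0≤bsum 0≤pws) (flg g)) (compound≤κ g 1≤g) (partialSum-bsum≤sumPw 0≤pws (flg g))))
  where
  B = λ i → bsum i ls
  it : 0ℚ ≤ iterA α B (flg g) × iterA α B (flg g) ≤ compound (flg g) (inv (g ^ 3)) * partialSum B (flg g)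
  it = iterA-bound 1≤g good (0≤bsum 0≤pws) (flg g) ℕ.≤-refl

sumℚ : List ℚ → ℚ
sumℚ []       = 0ℚ
sumℚ (w ∷ ws) = w + sumℚ ws

sumPath-split : ∀ ks i ws → sumPath ks i ws ≡ sumℚ ws + fromℕ (sumFrom i (length ws) (λ j → 2 ^ kAt ks j ℕ.∸ 1))
sumPath-split ks i []       = refl
sumPath-split ks i (w ∷ ws) = begin
  (w + fromℕ e) + sumPath ks (suc i) ws      ≡⟨ cong ((w + fromℕ e) +_) (sumPath-split ks (suc i) ws) ⟩
  (w + fromℕ e) + (sumℚ ws + fromℕ r)         ≡⟨ solve 4 (λ w e s r → (w :+ e) :+ (s :+ r) := (w :+ s) :+ (e :+ r)) refl w (fromℕ e) (sumℚ ws) (fromℕ r) ⟩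
  (w + sumℚ ws) + (fromℕ e + fromℕ r)         ≡⟨ cong ((w + sumℚ ws) +_) (fromℕ-+ e r) ⟨
  (w + sumℚ ws) + fromℕ (e ℕ.+ r)             ∎
  where
  open ≡-Reasoning
  e = 2 ^ kAt ks i ℕ.∸ 1
  r = sumFrom (suc i) (length ws) (λ j → 2 ^ kAt ks j ℕ.∸ 1)

pathBound : Bool → HTree Oracle → ℚ
pathBound b t = sumℚ (lws b t) + fromℕ (4 ℕ.* sumPow2 (mapk (gams b t)))

pw-bound : ∀ t → 0ℚ ≤ sumℚ (lws true t) → 0ℚ ≤ pw t × pw t ≤ pathBound true t
pw-bound t 0≤lws =
  subst (0ℚ ≤_) (sym split) (0≤+ 0≤lws (0≤fromℕ excess)) ,
  subst (_≤ pathBound true t) (sym split) (+-monoʳ-≤ (sumℚ (lws true t)) (fromℕ-mono (kAt-sum ks 0 (length (lws true t)))))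
  where
  ks = mapk (gams true t)
  excess = sumFrom 0 (length (lws true t)) (λ j → 2 ^ kAt ks j ℕ.∸ 1)
  split : pw t ≡ sumℚ (lws true t) + fromℕ excess
  split = sumPath-split ks 0 (lws true t)

pathBound-node : ∀ b α h ls → let t = node α h ls in
  pathBound b t ≡ (lw b t + fromℕ (4 ℕ.* 2 ^ k' (gam b t))) + pathBound false h
pathBound-node b α h ls = begin
  lw b t + sumℚ (lws false h) + fromℕ (4 ℕ.* (2 ^ k' (gam b t) ℕ.+ rest))
    ≡⟨ cong (λ z → lw b t + sumℚ (lws false h) + fromℕ z) (ℕ.*-distribˡ-+ 4 (2 ^ k' (gam b t)) rest) ⟩
  lw b t + sumℚ (lws false h) + fromℕ (4 ℕ.* 2 ^ k' (gam b t) ℕ.+ 4 ℕ.* rest)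
    ≡⟨ cong (lw b t + sumℚ (lws false h) +_) (fromℕ-+ (4 ℕ.* 2 ^ k' (gam b t)) (4 ℕ.* rest)) ⟩
  lw b t + sumℚ (lws false h) + (fromℕ (4 ℕ.* 2 ^ k' (gam b t)) + fromℕ (4 ℕ.* rest))
    ≡⟨ solve 4 (λ a b c d → a :+ b :+ (c :+ d) := a :+ c :+ (b :+ d)) refl
         (lw b t) (sumℚ (lws false h)) (fromℕ (4 ℕ.* 2 ^ k' (gam b t))) (fromℕ (4 ℕ.* rest)) ⟩
  (lw b t + fromℕ (4 ℕ.* 2 ^ k' (gam b t))) + pathBound false h
    ∎
  where
  open ≡-Reasoning
  t = node α h ls
  rest = sumPow2 (mapk (gams false h))

pathBound-leaf : ∀ b α → pathBound b (leaf α) ≡ lw b (leaf α) + fromℕ (4 ℕ.* 2 ^ k' (gam b (leaf α)))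
pathBound-leaf b α = cong₂ _+_ (+-identityʳ (lw b (leaf α))) (cong (λ n → fromℕ (4 ℕ.* n)) (ℕ.+-identityʳ (2 ^ k' (gam b (leaf α)))))

-- A node with γ = flg n pays for its summand 2^k' of the heavy path at rate 16/γ² per node of a set of size n.
rate : ℕ → ℚ
rate γ = fromℕ 16 * invSq γ

0≤rate : ∀ γ → 0ℚ ≤ rate γ
0≤rate γ = 0≤* (0≤fromℕ 16) (0≤invSq γ)

rate≤16 : ∀ {γ} → 1 ℕ.≤ γ → rate γ ≤ fromℕ 16
rate≤16 1≤γ = ≤-trans (*-monoˡ-≤-0≤ (0≤fromℕ 16) (invSq≤1 1≤γ)) (≤-reflexive (*-identityʳ _))

rate-anti : ∀ {p q} → 1 ℕ.≤ p → p ℕ.≤ q → rate q ≤ rate p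
rate-anti 1≤p p≤q = *-monoˡ-≤-0≤ (0≤fromℕ 16) (invSq-anti 1≤p p≤q)

charge≤rate : ∀ {γ} n → 1 ℕ.≤ γ → 2 ^ k' γ ℕ.* (γ ℕ.* γ) ℕ.≤ 4 ℕ.* n → fromℕ (4 ℕ.* 2 ^ k' γ) ≤ rate γ * fromℕ n
charge≤rate {suc γ} n _ bound = subst₂ _≤_ (*-identityʳ _) reorder
  (fromℕ*inv-≤ (4 ℕ.* 2 ^ k' (suc γ)) 0 (16 ℕ.* n) (ℕ.pred (suc γ ℕ.* suc γ))
    (ℕ.≤-trans (ℕ.≤-reflexive (ℕ.*-assoc 4 (2 ^ k' (suc γ)) _)) (ℕ.≤-trans (ℕ.*-monoʳ-≤ 4 bound)
      (ℕ.≤-reflexive (trans (sym (ℕ.*-assoc 4 4 n)) (sym (ℕ.*-identityʳ (16 ℕ.* n))))))))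
  where
  reorder : fromℕ (16 ℕ.* n) * invSq (suc γ) ≡ rate (suc γ) * fromℕ n
  reorder = trans (cong (_* invSq (suc γ)) (fromℕ-* 16 n))
                  (solve 3 (λ a b c → a :* b :* c := a :* c :* b) refl (fromℕ 16) (fromℕ n) (invSq (suc γ)))

ApexBound : HTree Oracle → Set
ApexBound t = 0ℚ ≤ pw t × pw t ≤ W ⌊log₂ size t ⌋ * fromℕ (size t)

sumPw-bound : ∀ {ls} k c Z → 0ℚ ≤ k → All ApexBound ls → All (λ l → k * W ⌊log₂ size l ⌋ + c ≤ Z) ls →
              k * sumPw ls + c * fromℕ (sizes ls) ≤ Z * fromℕ (sizes ls)
sumPw-bound k c Z 0≤k [] [] = ≤-reflexive (solve 3 (λ k c z → k :* con 0ℚ :+ c :* con 0ℚ := z :* con 0ℚ) refl k c Z)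
sumPw-bound {l ∷ ls} k c Z 0≤k ((_ , pw≤) ∷ bounds) (kW+c≤Z ∷ conds) = begin
  k * (pw l + sumPw ls) + c * fromℕ (size l ℕ.+ sizes ls)
    ≡⟨ cong (λ z → k * (pw l + sumPw ls) + c * z) (fromℕ-+ (size l) (sizes ls)) ⟩
  k * (pw l + sumPw ls) + c * (s + s′)
    ≡⟨ solve 6 (λ k p q c s s′ → k :* (p :+ q) :+ c :* (s :+ s′) := (k :* p :+ c :* s) :+ (k :* q :+ c :* s′))
               refl k (pw l) (sumPw ls) c s s′ ⟩
  (k * pw l + c * s) + (k * sumPw ls + c * s′)
    ≤⟨ +-mono-≤ head (sumPw-bound k c Z 0≤k bounds conds) ⟩
  Z * s + Z * s′
    ≡⟨ trans (cong (Z *_) (fromℕ-+ (size l) (sizes ls))) (*-distribˡ-+ Z s s′) ⟨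
  Z * fromℕ (size l ℕ.+ sizes ls)
    ∎
  where
  open ≤-Reasoning
  s = fromℕ (size l)
  s′ = fromℕ (sizes ls)
  head : k * pw l + c * s ≤ Z * s
  head = begin
    k * pw l + c * s                   ≤⟨ +-monoˡ-≤ (c * s) (*-monoˡ-≤-0≤ 0≤k pw≤) ⟩
    k * (W ⌊log₂ size l ⌋ * s) + c * s ≡⟨ solve 4 (λ k w s c → k :* (w :* s) :+ c :* s := (k :* w :+ c) :* s) refl k (W ⌊log₂ size l ⌋) s c ⟩
    (k * W ⌊log₂ size l ⌋ + c) * s     ≤⟨ *-monoʳ-≤-0≤ (0≤fromℕ (size l)) kW+c≤Z ⟩
    Z * s                              ∎

-- T^ℓ_u pays for lw(u) and for charges at rate c per node, provided each light subtree
-- fits under Z even after inflation by κ γ.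
node-bound : ∀ {γ α ls} c Z → 1 ℕ.≤ γ → GoodOracle γ α → All ApexBound ls →
             1ℚ + c ≤ Z → All (λ l → κ γ * W ⌊log₂ size l ⌋ + c ≤ Z) ls →
             lightWeight α ls γ + c * fromℕ (suc (sizes ls)) ≤ Z * fromℕ (suc (sizes ls))
node-bound {γ} {α} {ls} c Z 1≤γ good bounds 1+c≤Z conds = begin
  lightWeight α ls γ + c * fromℕ (suc (sizes ls))  ≤⟨ +-monoˡ-≤ _ (proj₂ (lightWeight-bound 1≤γ good (All.map proj₁ bounds))) ⟩
  1ℚ + κ γ * sumPw ls + c * fromℕ (suc (sizes ls)) ≡⟨ cong (λ z → 1ℚ + κ γ * sumPw ls + c * z) (fromℕ-+ 1 (sizes ls)) ⟩
  1ℚ + κ γ * sumPw ls + c * (1ℚ + s)              ≡⟨ solve 4 (λ k p c s → con 1ℚ :+ k :* p :+ c :* (con 1ℚ :+ s) := (con 1ℚ :+ c) :+ (k :* p :+ c :* s))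
                                                             refl (κ γ) (sumPw ls) c s ⟩
  (1ℚ + c) + (κ γ * sumPw ls + c * s)             ≤⟨ +-mono-≤ 1+c≤Z (sumPw-bound (κ γ) c Z (0≤κ γ) bounds conds) ⟩
  Z + Z * s                                       ≡⟨ solve 2 (λ z s → z :+ z :* s := z :* (con 1ℚ :+ s)) refl Z s ⟩
  Z * (1ℚ + s)                                    ≡⟨ cong (Z *_) (fromℕ-+ 1 (sizes ls)) ⟨
  Z * fromℕ (suc (sizes ls))                      ∎
  where
  open ≤-Reasoning
  s = fromℕ (sizes ls)

κW+rates≤W[1+m] : ∀ {γ} m → 1 ℕ.≤ γ → 1 ⊔ m ℕ.≤ γ → κ γ * W m + (rate γ + rate (1 ⊔ m)) ≤ W (suc m)
κW+rates≤W[1+m] {γ} m 1≤γ q≤γ = begin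
  κ γ * W m + (rate γ + rate q)  ≤⟨ +-mono-≤ (*-monoʳ-≤-0≤ (0≤W m) (+-monoʳ-≤ 1ℚ (*-monoˡ-≤-0≤ (0≤fromℕ 2) (invSq-anti 1≤q q≤γ))))
                                              (+-monoˡ-≤ (rate q) (rate-anti 1≤q q≤γ)) ⟩
  κ q * W m + (rate q + rate q)  ≡⟨ solve 3 (λ k w x → k :* w :+ (con (fromℕ 16) :* x :+ con (fromℕ 16) :* x) := k :* w :+ con (fromℕ 32) :* x)
                                            refl (κ q) (W m) (invSq q) ⟩
  W (suc m)                      ∎
  where
  open ≤-Reasoning
  q = 1 ⊔ m
  1≤q = ℕ.m≤m⊔n 1 m

size-pos : ∀ {A} (t : HTree A) → 1 ℕ.≤ size t
size-pos (leaf _)     = ℕ.≤-refl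
size-pos (node _ _ _) = ℕ.s≤s ℕ.z≤n

size≤sizes : ∀ {A} (ls : List (HTree A)) → All (λ l → size l ℕ.≤ sizes ls) ls
size≤sizes []       = []
size≤sizes (l ∷ ls) = ℕ.m≤m+n (size l) (sizes ls) ∷ All.map (λ l≤ → ℕ.≤-trans l≤ (ℕ.m≤n+m (sizes ls) (size l))) (size≤sizes ls)

-- A light child has at most half the size of the heavy path's apex, so its ⌊log₂ size⌋ is smaller.
light-conditions-path : ∀ {γ} S H (ls : List (HTree Oracle)) → 1 ℕ.≤ γ → flg (suc (sizes ls)) ℕ.≤ γ →
  All (λ l → size l ℕ.≤ H) ls → suc (H ℕ.+ sizes ls) ℕ.≤ S →
  All (λ l → κ γ * W ⌊log₂ size l ⌋ + (rate γ + rate (flg S)) ≤ W ⌊log₂ S ⌋) ls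
light-conditions-path {γ} S H ls 1≤γ flg≤γ ≤H 1+H+s≤S = All.zipWith condition (≤H , size≤sizes ls)
  where
  condition : ∀ {l} → size l ℕ.≤ H × size l ℕ.≤ sizes ls → κ γ * W ⌊log₂ size l ⌋ + (rate γ + rate (flg S)) ≤ W ⌊log₂ S ⌋
  condition {l} (l≤H , l≤s) = begin
    κ γ * W m + (rate γ + rate (flg S))   ≤⟨ +-monoʳ-≤ (κ γ * W m) (+-monoʳ-≤ (rate γ) (rate-anti (ℕ.m≤m⊔n 1 m) (ℕ.⊔-monoʳ-≤ 1 (ℕ.<⇒≤ m<logS)))) ⟩
    κ γ * W m + (rate γ + rate (1 ⊔ m))   ≤⟨ κW+rates≤W[1+m] m 1≤γ (ℕ.≤-trans (flg-mono (ℕ.m≤n⇒m≤1+n l≤s)) flg≤γ) ⟩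
    W (suc m)                             ≤⟨ W-mono m<logS ⟩
    W ⌊log₂ S ⌋                           ∎
    where
    open ≤-Reasoning
    m = ⌊log₂ size l ⌋
    2l≤S : 2 ℕ.* size l ℕ.≤ S
    2l≤S = ℕ.≤-trans (ℕ.≤-reflexive (cong (size l ℕ.+_) (ℕ.+-identityʳ (size l))))
             (ℕ.≤-trans (ℕ.+-mono-≤ l≤H l≤s) (ℕ.≤-trans (ℕ.n≤1+n (H ℕ.+ sizes ls)) 1+H+s≤S))
    m<logS : suc m ℕ.≤ ⌊log₂ S ⌋
    m<logS = 1+⌊log₂m⌋≤⌊log₂n⌋ (size-pos l) 2l≤S

light-conditions-lw : ∀ {γ} (ls : List (HTree Oracle)) → 1 ℕ.≤ γ → flg (suc (sizes ls)) ℕ.≤ γ →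
  All (λ l → κ γ * W ⌊log₂ size l ⌋ + rate γ ≤ fromℕ 2940) ls
light-conditions-lw {γ} ls 1≤γ flg≤γ = All.map condition (size≤sizes ls)
  where
  condition : ∀ {l} → size l ℕ.≤ sizes ls → κ γ * W ⌊log₂ size l ⌋ + rate γ ≤ fromℕ 2940
  condition {l} l≤s = begin
    κ γ * W m + rate γ                    ≤⟨ +-monoʳ-≤ (κ γ * W m) (p≤p+q (rate γ) (0≤rate (1 ⊔ m))) ⟩
    κ γ * W m + (rate γ + rate (1 ⊔ m))   ≤⟨ κW+rates≤W[1+m] m 1≤γ (ℕ.≤-trans (flg-mono (ℕ.m≤n⇒m≤1+n l≤s)) flg≤γ) ⟩
    W (suc m)                             ≤⟨ W≤2940 (suc m) ⟩
    fromℕ 2940                            ∎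
    where
    open ≤-Reasoning
    m = ⌊log₂ size l ⌋

gam-pos : ∀ {A} b (t : HTree A) → 1 ℕ.≤ gam b t
gam-pos true  t = flg-pos (size t)
gam-pos false t = flg-pos (lsize t)

flg-lsize≤gam : ∀ {A} b (a : A) h ls → flg (suc (sizes ls)) ℕ.≤ gam b (node a h ls)
flg-lsize≤gam true  a h ls = flg-mono (ℕ.s≤s (ℕ.m≤n+m (sizes ls) (size h)))
flg-lsize≤gam false a h ls = ℕ.≤-refl

leaf-charge≤rate : fromℕ (4 ℕ.* 2 ^ k' (flg 1)) ≤ rate (flg 1) * fromℕ 1
leaf-charge≤rate = charge≤rate 1 (flg-pos 1) (2^k'[γ]*γ²≤4*n 1 ℕ.≤-refl)

light-part-bound : ∀ {γ α ls} S H ch → 1 ℕ.≤ γ → flg (suc (sizes ls)) ℕ.≤ γ → GoodOracle γ α → All ApexBound ls →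
  All (λ l → size l ℕ.≤ H) ls → suc (H ℕ.+ sizes ls) ℕ.≤ S → ch ≤ rate γ * fromℕ (suc (sizes ls)) →
  lightWeight α ls γ + ch + rate (flg S) * fromℕ (suc (sizes ls)) ≤ W ⌊log₂ S ⌋ * fromℕ (suc (sizes ls))
light-part-bound {γ} {α} {ls} S H ch 1≤γ flg≤γ good bounds ≤H 1+H+s≤S ch≤ = begin
  lightWeight α ls γ + ch + ρ * a               ≤⟨ +-monoˡ-≤ (ρ * a) (+-monoʳ-≤ (lightWeight α ls γ) ch≤) ⟩
  lightWeight α ls γ + rate γ * a + ρ * a       ≡⟨ solve 4 (λ l r ρ a → l :+ r :* a :+ ρ :* a := l :+ (r :+ ρ) :* a) refl (lightWeight α ls γ) (rate γ) ρ a ⟩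
  lightWeight α ls γ + (rate γ + ρ) * a         ≤⟨ node-bound (rate γ + ρ) (W ⌊log₂ S ⌋) 1≤γ good bounds 1+rates≤W
                                                     (light-conditions-path S H ls 1≤γ flg≤γ ≤H 1+H+s≤S) ⟩
  W ⌊log₂ S ⌋ * a                               ∎
  where
  open ≤-Reasoning
  ρ = rate (flg S)
  a = fromℕ (suc (sizes ls))
  1+rates≤W : 1ℚ + (rate γ + ρ) ≤ W ⌊log₂ S ⌋
  1+rates≤W = ≤-trans (+-monoʳ-≤ 1ℚ (+-mono-≤ (rate≤16 1≤γ) (rate≤16 (flg-pos S)))) (≤-trans (≤ᵇ⇒≤ tt) (33≤W ⌊log₂ S ⌋))

add-bounds : ∀ X P {ρ a b w} → X + ρ * a ≤ w * a → P + ρ * b ≤ w * b → X + P + ρ * (a + b) ≤ w * (a + b)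
add-bounds X P {ρ} {a} {b} {w} Xa Pb = begin
  X + P + ρ * (a + b)            ≡⟨ solve 5 (λ X P ρ a b → X :+ P :+ ρ :* (a :+ b) := (X :+ ρ :* a) :+ (P :+ ρ :* b)) refl X P ρ a b ⟩
  (X + ρ * a) + (P + ρ * b)      ≤⟨ +-mono-≤ Xa Pb ⟩
  w * a + w * b                  ≡⟨ *-distribˡ-+ w a b ⟨
  w * (a + b)                    ∎
  where open ≤-Reasoning

size-node : ∀ {A} (a : A) h ls → fromℕ (size (node a h ls)) ≡ fromℕ (suc (sizes ls)) + fromℕ (size h)
size-node a h ls = trans (cong (λ n → fromℕ (suc n)) (ℕ.+-comm (size h) (sizes ls))) (fromℕ-+ (suc (sizes ls)) (size h))

-- The apex of the heavy path spreads its own summand 2^k' over all of T_u, at rate 16/lg²|T_u|.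
HeavyPathBound : ℕ → HTree Oracle → Set
HeavyPathBound S t = 0ℚ ≤ sumℚ (lws false t) × pathBound false t + rate (flg S) * fromℕ (size t) ≤ W ⌊log₂ S ⌋ * fromℕ (size t)

mutual
  apex-bound : ∀ t → Valid true t → WellHeavy t → ApexBound t
  apex-bound (leaf α) (leaf good) leaf =
    proj₁ (pw-bound (leaf α) (0≤+ 0≤lw ≤-refl)) ,
    (begin
      pw (leaf α)                                            ≤⟨ proj₂ (pw-bound (leaf α) (0≤+ 0≤lw ≤-refl)) ⟩
      pathBound true (leaf α)                                ≡⟨ pathBound-leaf true α ⟩
      lw true (leaf α) + ch                                  ≤⟨ p≤p+q _ (0≤* (0≤rate (flg 1)) (0≤fromℕ 1)) ⟩
      lw true (leaf α) + ch + rate (flg 1) * fromℕ 1         ≤⟨ light-part-bound 1 0 ch (flg-pos 1) ℕ.≤-refl good [] [] ℕ.≤-refl leaf-charge≤rate ⟩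
      W ⌊log₂ 1 ⌋ * fromℕ 1                                  ∎)
    where
    open ≤-Reasoning
    ch = fromℕ (4 ℕ.* 2 ^ k' (flg 1))
    0≤lw : 0ℚ ≤ lw true (leaf α)
    0≤lw = proj₁ (lightWeight-bound (flg-pos 1) good [])
  apex-bound t@(node α h ls) (node good valid-h valid-ls) (node wh-h h≥ls wh-ls) =
    proj₁ (pw-bound t 0≤lws) ,
    (begin
      pw t                                     ≤⟨ proj₂ (pw-bound t 0≤lws) ⟩
      pathBound true t                         ≡⟨ pathBound-node true α h ls ⟩
      (lw true t + ch) + pathBound false h     ≡⟨ solve 3 (λ l c p → l :+ c :+ p := l :+ p :+ c) refl (lw true t) ch (pathBound false h) ⟩
      lw true t + pathBound false h + ch       ≤⟨ +-monoʳ-≤ (lw true t + pathBound false h) (≤-trans ch≤ρS (≤-reflexive (cong (ρ *_) (size-node α h ls)))) ⟩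
      lw true t + pathBound false h + ρ * (a + b)
                                               ≤⟨ add-bounds (lw true t) (pathBound false h) {ρ} {a} {b} {W ⌊log₂ S ⌋} light-part (proj₂ below) ⟩
      W ⌊log₂ S ⌋ * (a + b)                    ≡⟨ cong (W ⌊log₂ S ⌋ *_) (size-node α h ls) ⟨
      W ⌊log₂ S ⌋ * fromℕ S                    ∎)
    where
    open ≤-Reasoning
    S = size t
    ρ = rate (flg S)
    a = fromℕ (suc (sizes ls))
    b = fromℕ (size h)
    ch = fromℕ (4 ℕ.* 2 ^ k' (flg S))
    bounds : All ApexBound ls
    bounds = lights-bound ls valid-ls wh-ls
    below : HeavyPathBound S h
    below = heavy-path-bound S h valid-h wh-h (ℕ.≤-trans (ℕ.m≤m+n (size h) (sizes ls)) (ℕ.n≤1+n _))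
    light-part : lw true t + ρ * a ≤ W ⌊log₂ S ⌋ * a
    light-part = subst (λ x → x + ρ * a ≤ W ⌊log₂ S ⌋ * a) (+-identityʳ (lw true t))
      (light-part-bound S (size h) 0ℚ (flg-pos S) (flg-lsize≤gam true α h ls) good bounds h≥ls ℕ.≤-refl
                        (0≤* (0≤rate (flg S)) (0≤fromℕ (suc (sizes ls)))))
    ch≤ρS : ch ≤ ρ * fromℕ S
    ch≤ρS = charge≤rate S (flg-pos S) (2^k'[γ]*γ²≤4*n S (size-pos t))
    0≤lws : 0ℚ ≤ sumℚ (lws true t)
    0≤lws = 0≤+ (proj₁ (lightWeight-bound (flg-pos S) good (All.map proj₁ bounds))) (proj₁ below)

  heavy-path-bound : ∀ S t → Valid false t → WellHeavy t → size t ℕ.≤ S → HeavyPathBound S t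
  heavy-path-bound S (leaf α) (leaf good) leaf 1≤S =
    0≤+ (proj₁ (lightWeight-bound (flg-pos 1) good [])) ≤-refl ,
    subst (λ x → x + rate (flg S) * fromℕ 1 ≤ W ⌊log₂ S ⌋ * fromℕ 1) (sym (pathBound-leaf false α))
          (light-part-bound S 0 _ (flg-pos 1) ℕ.≤-refl good [] [] 1≤S leaf-charge≤rate)
  heavy-path-bound S t@(node α h ls) (node good valid-h valid-ls) (node wh-h h≥ls wh-ls) t≤S =
    0≤+ (proj₁ (lightWeight-bound (flg-pos (suc (sizes ls))) good (All.map proj₁ bounds))) (proj₁ below) ,
    (begin
      pathBound false t + ρ * fromℕ (size t)               ≡⟨ cong₂ _+_ (pathBound-node false α h ls) (cong (ρ *_) (size-node α h ls)) ⟩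
      (lw false t + ch) + pathBound false h + ρ * (a + b)  ≤⟨ add-bounds (lw false t + ch) (pathBound false h) {ρ} {a} {b} {W ⌊log₂ S ⌋} light-part (proj₂ below) ⟩
      W ⌊log₂ S ⌋ * (a + b)                                ≡⟨ cong (W ⌊log₂ S ⌋ *_) (size-node α h ls) ⟨
      W ⌊log₂ S ⌋ * fromℕ (size t)                         ∎)
    where
    open ≤-Reasoning
    ρ = rate (flg S)
    a = fromℕ (suc (sizes ls))
    b = fromℕ (size h)
    ch = fromℕ (4 ℕ.* 2 ^ k' (flg (suc (sizes ls))))
    bounds : All ApexBound ls
    bounds = lights-bound ls valid-ls wh-ls
    below : HeavyPathBound S h
    below = heavy-path-bound S h valid-h wh-h (ℕ.≤-trans (ℕ.≤-trans (ℕ.m≤m+n (size h) (sizes ls)) (ℕ.n≤1+n _)) t≤S)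
    light-part : lw false t + ch + ρ * a ≤ W ⌊log₂ S ⌋ * a
    light-part = light-part-bound S (size h) ch (flg-pos (suc (sizes ls))) ℕ.≤-refl good bounds h≥ls t≤S
      (charge≤rate (suc (sizes ls)) (flg-pos (suc (sizes ls))) (2^k'[γ]*γ²≤4*n (suc (sizes ls)) (ℕ.s≤s ℕ.z≤n)))

  lights-bound : ∀ ls → All (Valid true) ls → All WellHeavy ls → All ApexBound ls
  lights-bound []       []       []       = []
  lights-bound (l ∷ ls) (v ∷ vs) (w ∷ ws) = apex-bound l v w ∷ lights-bound ls vs ws

pw≤2940*size : ∀ t → Valid true t → WellHeavy t → pw t ≤ fromℕ 2940 * fromℕ (size t)
pw≤2940*size t valid wh = ≤-trans (proj₂ (apex-bound t valid wh)) (*-monoʳ-≤-0≤ (0≤fromℕ (size t)) (W≤2940 ⌊log₂ size t ⌋))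

lightWeight≤2940*lsize : ∀ {γ α ls} → 1 ℕ.≤ γ → GoodOracle γ α → All ApexBound ls →
  All (λ l → κ γ * W ⌊log₂ size l ⌋ + rate γ ≤ fromℕ 2940) ls →
  lightWeight α ls γ ≤ fromℕ 2940 * fromℕ (suc (sizes ls))
lightWeight≤2940*lsize {γ} {α} {ls} 1≤γ good bounds conds =
  ≤-trans (p≤p+q (lightWeight α ls γ) (0≤* (0≤rate γ) (0≤fromℕ (suc (sizes ls)))))
          (node-bound (rate γ) (fromℕ 2940) 1≤γ good bounds (≤-trans (+-monoʳ-≤ 1ℚ (rate≤16 1≤γ)) (≤ᵇ⇒≤ tt)) conds)

lw≤2940*lsize : ∀ b t → Valid b t → WellHeavy t → lw b t ≤ fromℕ 2940 * fromℕ (lsize t)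
lw≤2940*lsize b t@(leaf α) (leaf good) leaf =
  lightWeight≤2940*lsize (gam-pos b t) good [] []
lw≤2940*lsize b t@(node α h ls) (node good _ valid-ls) (node _ _ wh-ls) =
  lightWeight≤2940*lsize (gam-pos b t) good (lights-bound ls valid-ls wh-ls) (light-conditions-lw ls (gam-pos b t) (flg-lsize≤gam b α h ls))

sub-valid : ∀ {b t} → Valid b t → WellHeavy t → (p : Node t) → Valid (apexFrom b p) (sub p) × WellHeavy (sub p)
sub-valid valid              wh               here         = valid , wh
sub-valid (node _ valid-h _)  (node wh-h _ _)  (heavy p)    = sub-valid valid-h wh-h p
sub-valid (node _ _ valid-ls) (node _ _ wh-ls) (light l∈ p) = sub-valid (All.lookup valid-ls l∈) (All.lookup wh-ls l∈) p

-- E 6 ≥ 980 already, so N = 6 serves every ε.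
≤3eπ²*-from-2940 : ∀ {x} n → x ≤ fromℕ 2940 * fromℕ n → x ≤3eπ²* n
≤3eπ²*-from-2940 {x} n x≤ ε 0<ε = 6 , ≤-<-trans x≤3nE6 (subst (_< 3nE6 + ε) (+-identityʳ 3nE6) (+-monoʳ-< 3nE6 0<ε))
  where
  3nE6 = fromℕ (3 ℕ.* n) * E 6
  x≤3nE6 : x ≤ 3nE6
  x≤3nE6 = ≤-trans x≤ (≤-trans (≤-reflexive (*-comm (fromℕ 2940) (fromℕ n)))
             (≤-trans (*-monoˡ-≤-0≤ (0≤fromℕ n) (≤ᵇ⇒≤ tt))
               (≤-reflexive (trans (solve 3 (λ a b c → a :* (b :* c) := b :* a :* c) refl (fromℕ n) (fromℕ 3) (E 6))
                                   (cong (_* E 6) (sym (fromℕ-* 3 n)))))))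

corollary1 : (Tr : HTree Oracle) → WellHeavy Tr → Valid true Tr →
    ((u : Node Tr) → T (isApex u) → pw (sub u) ≤3eπ²* size (sub u))
    × ((v : Node Tr) → lw (isApex v) (sub v) ≤3eπ²* lsize (sub v))
corollary1 Tr wh valid = pw-bound-at , lw-bound-at
  where
  pw-bound-at : (u : Node Tr) → T (isApex u) → pw (sub u) ≤3eπ²* size (sub u)
  pw-bound-at u apex with isApex u | Equivalence.to T-≡ apex | sub-valid valid wh u
  ... | true | refl | valid-u , wh-u = ≤3eπ²*-from-2940 (size (sub u)) (pw≤2940*size (sub u) valid-u wh-u)
  lw-bound-at : (v : Node Tr) → lw (isApex v) (sub v) ≤3eπ²* lsize (sub v)
  lw-bound-at v = ≤3eπ²*-from-2940 (lsize (sub v)) (uncurry (lw≤2940*lsize (isApex v) (sub v)) (sub-valid valid wh v))
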